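{- Let $m\ge n$ be positive integers with $\gcd(n,m)\le 3$. Then $\mathrm{opt}^{P}_{B}(\mathcal{K}_{n+1,m+1})=0$; that is, with no blocks at all, starting from $(1,1)$ the robot can pass over every square of $\mathcal{K}_{n+1,m+1}$.
   Context: $\mathcal{K}_{n+1,m+1}$ is the king grid with $n+1$ rows and $m+1$ columns, squares $(i,j)$ with $1\le i\le n+1$, $1\le j\le m+1$. Blocks may occupy squares; a robot starts at $(1,1)$. A move: choose one of the eight directions (horizontal, vertical, or diagonal); the robot slides in that direction and stops on the last free square before it would enter a block or leave the grid. The robot passes over every square it occupies during a move. $\mathrm{opt}^{P}_{B}(\mathcal{K}_{n+1,m+1})$ is the minimum number of blocks such that every free square is passed over during some sequence of moves from $(1,1)$. -}

module Defs where

open import Data.Nat using (ℕ; zero; suc; _+_; _∸_; _≤_; _<_; _≤ᵇ_)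
open import Data.Bool using (Bool; true; false; if_then_else_)
open import Data.Product using (_×_; _,_; ∃-syntax)
open import Data.List using (List; []; _∷_)
open import Data.List.Membership.Propositional using (_∈_)

-- The king grid K_{n+1,m+1} with NO blocks.  Squares are 0-indexed:
-- (i , j) with i ≤ n (row), j ≤ m (column); paper square (i+1, j+1).
-- The robot starts at (0 , 0), i.e. paper square (1,1).

Square : Set
Square = ℕ × ℕ

data Dir : Set where
  N S E W NE NW SE SW : Dir

-- Row index increases with S, column index increases with E.

canDec : ℕ → Bool
canDec zero    = false
canDec (suc _) = true

canInc : ℕ → ℕ → Bool
canInc b x = suc x ≤ᵇ b

inGridStep : ℕ → ℕ → Dir → Square → Bool
inGridStep n m N  (i , j) = canDec i
inGridStep n m S  (i , j) = canInc n i
inGridStep n m E  (i , j) = canInc m j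
inGridStep n m W  (i , j) = canDec j
inGridStep n m NE (i , j) = if canDec i then canInc m j else false
inGridStep n m NW (i , j) = if canDec i then canDec j else false
inGridStep n m SE (i , j) = if canInc n i then canInc m j else false
inGridStep n m SW (i , j) = if canInc n i then canDec j else false

-- The square one step further in direction d (only used when in grid).
step : Dir → Square → Square
step N  (i , j) = (i ∸ 1 , j)
step S  (i , j) = (suc i , j)
step E  (i , j) = (i , suc j)
step W  (i , j) = (i , j ∸ 1)
step NE (i , j) = (i ∸ 1 , suc j)
step NW (i , j) = (i ∸ 1 , j ∸ 1)
step SE (i , j) = (suc i , suc j)
step SW (i , j) = (suc i , j ∸ 1)

-- Fuel suffices: any slide has at most
-- n + m steps, and we use fuel n + m + 1.
slideFuel : ℕ → ℕ → ℕ → Dir → Square → List Square × Square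
slideFuel n m zero    d p = (p ∷ [] , p)
slideFuel n m (suc k) d p with inGridStep n m d p
... | false = (p ∷ [] , p)
... | true  with slideFuel n m k d (step d p)
...   | (ps , q) = (p ∷ ps , q)

slide : ℕ → ℕ → Dir → Square → List Square × Square
slide n m d p = slideFuel n m (suc (n + m)) d p

passed : ℕ → ℕ → Square → List Dir → List Square
passed n m p []       = p ∷ []
passed n m p (d ∷ ds) with slide n m d p
... | (ps , q) = ps Data.List.++ passed n m q ds

AllCoveredNoBlocks : ℕ → ℕ → Set
AllCoveredNoBlocks n m =
  ∃[ ds ] (∀ i j → i ≤ n → j ≤ m → (i , j) ∈ passed n m (0 , 0) ds)

module Submission where

-- The columns x with (0, x) reachable contain 0 and are closed
--    under x ↦ n − x, x ↦ m − x, x ↦ x + n and x ↦ x − n (each a short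
--    sequence of slides to the bottom or side edge and back).  An abstract
--    subtractive Euclidean algorithm on such closure properties
--    (closed⇒multiples) shows that every multiple of gcd n m is reachable.
-- 2. Every square.  A square (i, j) is visited as soon as gcd n m divides its
--    row, column, anti-diagonal index i + j or diagonal index |i − j|
--    (Aligned): slide from a reachable top-row square along that line.  For
--    d ≤ 3 every square is aligned with d, by inspecting residues mod d.
-- 3. Assembly.  Every walk can return to the corner by sliding N then W, so
--    the walks visiting single squares concatenate into one tour.

open import Defs
open import Data.Nat using (ℕ; zero; suc; _+_; _∸_; _*_; _≤_; _<_; z≤n; s≤s; _≤?_)
open import Data.Nat.Properties
open import Data.Nat.Induction using (<-rec)
open import Data.Nat.Tactic.RingSolver using (solve-∀)
open import Data.Nat.Divisibility
open import Data.Nat.DivMod using (_%_; _/_; m%n<n; m≡m%n+[m/n]*n)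
open import Data.Nat.GCD using (gcd; gcd-comm; gcd-identityˡ; gcd[m,n]∣m; gcd[m,n]∣n; gcd-greatest; gcd[m,n]≢0)
open import Data.Empty using (⊥-elim)
open import Data.Bool using (Bool; true; false; if_then_else_)
open import Data.Product using (Σ; _×_; _,_; proj₁; proj₂)
open import Data.Sum using (_⊎_; inj₁; inj₂)
open import Data.List using (List; []; _∷_; _++_; upTo; cartesianProduct)
open import Data.List.Membership.Propositional using (_∈_)
open import Data.List.Membership.Propositional.Properties
  using (∈-++⁺ˡ; ∈-++⁺ʳ; ∈-++⁻; ∈-upTo⁺; ∈-upTo⁻; ∈-cartesianProduct⁺; ∈-cartesianProduct⁻)
open import Data.List.Relation.Unary.Any using (here; there)
open import Relation.Nullary using (¬_; Dec; yes; no)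
open import Relation.Binary.PropositionalEquality

∣-∸ : ∀ {d a b} → d ∣ a → d ∣ b → b ≤ a → d ∣ a ∸ b
∣-∸ {d} da db b≤a = ∣m+n∣m⇒∣n (subst (d ∣_) (sym (m+[n∸m]≡n b≤a)) da) db

gcd-∸ : ∀ a b → a ≤ b → gcd a (b ∸ a) ≡ gcd a b
gcd-∸ a b a≤b = ∣-antisym
  (gcd-greatest (gcd[m,n]∣m a (b ∸ a))
    (subst (gcd a (b ∸ a) ∣_) (m+[n∸m]≡n a≤b) (∣m∣n⇒∣m+n (gcd[m,n]∣m a (b ∸ a)) (gcd[m,n]∣n a (b ∸ a)))))
  (gcd-greatest (gcd[m,n]∣m a b) (∣-∸ (gcd[m,n]∣n a b) (gcd[m,n]∣m a b) a≤b))

record Closed (P : ℕ → Set) (a b : ℕ) : Set where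
  field
    has-zero  : P 0
    reflect-a : ∀ x → x ≤ a → P x → P (a ∸ x)
    reflect-b : ∀ x → x ≤ b → P x → P (b ∸ x)
    shift-a   : ∀ x → x + a ≤ b → P x → P (x + a)
open Closed

module _ {P : ℕ → Set} {a b : ℕ} (a≤b : a ≤ b) (C : Closed P a b) where

  -- Translating by a and then reflecting about b is the reflection about b − a.
  reflect-diff : ∀ x → x ≤ b ∸ a → P x → P ((b ∸ a) ∸ x)
  reflect-diff x x≤b-a px = subst P b∸[x+a]≡b-a∸x (reflect-b C (x + a) x+a≤b (shift-a C x x+a≤b px))
    where
    x+a≤b : x + a ≤ b
    x+a≤b = subst (x + a ≤_) (m∸n+n≡m a≤b) (+-monoˡ-≤ a x≤b-a)
    b∸[x+a]≡b-a∸x : b ∸ (x + a) ≡ (b ∸ a) ∸ x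
    b∸[x+a]≡b-a∸x = trans (cong (b ∸_) (+-comm x a)) (sym (∸-+-assoc b a x))

  closed-left : Closed P a (b ∸ a)
  closed-left = record
    { has-zero  = has-zero C
    ; reflect-a = reflect-a C
    ; reflect-b = reflect-diff
    ; shift-a   = λ x le → shift-a C x (≤-trans le (m∸n≤m b a))
    }

  -- So does the pair (b − a, a): translating by b − a is the reflection about
  -- a followed by the reflection about b.
  closed-right : Closed P (b ∸ a) a
  closed-right = record
    { has-zero  = has-zero C
    ; reflect-a = reflect-diff
    ; reflect-b = reflect-a C
    ; shift-a   = shift
    }
    where
    shift : ∀ x → x + (b ∸ a) ≤ a → P x → P (x + (b ∸ a))
    shift x le px = subst P b∸[a∸x]≡x+[b∸a]
      (reflect-b C (a ∸ x) (≤-trans (m∸n≤m a x) a≤b) (reflect-a C x x≤a px))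
      where
      x≤a : x ≤ a
      x≤a = m+n≤o⇒m≤o x le
      b∸[a∸x]≡x+[b∸a] : b ∸ (a ∸ x) ≡ x + (b ∸ a)
      b∸[a∸x]≡x+[b∸a] = begin
        b ∸ (a ∸ x)                   ≡⟨ cong (_∸ (a ∸ x)) (sym (m+[n∸m]≡n a≤b)) ⟩
        (a + (b ∸ a)) ∸ (a ∸ x)       ≡⟨ cong (λ y → (y + (b ∸ a)) ∸ (a ∸ x)) (sym (m∸n+n≡m x≤a)) ⟩
        ((a ∸ x) + x + (b ∸ a)) ∸ (a ∸ x) ≡⟨ cong (_∸ (a ∸ x)) (+-assoc (a ∸ x) x (b ∸ a)) ⟩
        ((a ∸ x) + (x + (b ∸ a))) ∸ (a ∸ x) ≡⟨ m+n∸m≡n (a ∸ x) (x + (b ∸ a)) ⟩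
        x + (b ∸ a)                   ∎
        where open ≡-Reasoning

  -- If P contains the multiples of g up to b − a, where a ≤ b − a and g ∣ b,
  -- it contains those up to b: the rest is reflected into [0, a) about b.
  lift-left : ∀ {g} → g ∣ b → a ≤ b ∸ a →
              (∀ y → y ≤ b ∸ a → g ∣ y → P y) → ∀ x → x ≤ b → g ∣ x → P x
  lift-left g∣b a≤b-a low x x≤b g∣x with x ≤? b ∸ a
  ... | yes x≤b-a = low x x≤b-a g∣x
  ... | no  x≰b-a = subst P (m∸[m∸n]≡n x≤b)
          (reflect-b C (b ∸ x) (m∸n≤m b x) (low (b ∸ x) b∸x≤b-a (∣-∸ g∣b g∣x x≤b)))
    where
    b∸x≤b-a : b ∸ x ≤ b ∸ a
    b∸x≤b-a = ≤-trans (∸-monoʳ-≤ b (<⇒≤ (≰⇒> x≰b-a)))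
                      (≤-trans (≤-reflexive (m∸[m∸n]≡n a≤b)) a≤b-a)

  -- If P contains the multiples of g up to a, where b − a ≤ a and g ∣ a,
  -- it contains those up to b: the rest is translated down into [0, b − a].
  lift-right : ∀ {g} → g ∣ a → b ∸ a ≤ a →
               (∀ y → y ≤ a → g ∣ y → P y) → ∀ x → x ≤ b → g ∣ x → P x
  lift-right g∣a b-a≤a low x x≤b g∣x with x ≤? a
  ... | yes x≤a = low x x≤a g∣x
  ... | no  x≰a = subst P (m∸n+n≡m a≤x)
          (shift-a C (x ∸ a) (subst (_≤ b) (sym (m∸n+n≡m a≤x)) x≤b)
            (low (x ∸ a) (≤-trans (∸-monoˡ-≤ a x≤b) b-a≤a) (∣-∸ g∣x g∣a a≤x)))
    where
    a≤x : a ≤ x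
    a≤x = <⇒≤ (≰⇒> x≰a)

-- Euclid's algorithm on the closure properties: a set closed for (a, b)
-- contains every multiple of gcd a b in [0, b].  Recursion on a + b < size.
closed⇒multiples : ∀ {P} size a b → a + b < size → a ≤ b → Closed P a b →
                   ∀ x → x ≤ b → gcd a b ∣ x → P x
closed⇒multiples size zero b _ _ C zero _ _ = has-zero C
closed⇒multiples {P} size zero b _ _ C (suc x) x≤b b∣x =
  subst P (≤-antisym (subst (_≤ suc x) (gcd-identityˡ b) (∣⇒≤ b∣x)) x≤b) (reflect-b C 0 z≤n (has-zero C))
closed⇒multiples {P} (suc size) a@(suc _) b (s≤s a+b≤size) a≤b C = recurse (a ≤? b ∸ a)
  where
  -- both recursive pairs below have sum b < a + b
  b<size : b < size
  b<size = <-≤-trans (m<n+m b (s≤s z≤n)) a+b≤size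

  recurse : Dec (a ≤ b ∸ a) → ∀ x → x ≤ b → gcd a b ∣ x → P x
  recurse (yes a≤b-a) = lift-left a≤b C (gcd[m,n]∣n a b) a≤b-a λ y y≤b-a g∣y →
    closed⇒multiples size a (b ∸ a) (subst (_< size) (sym (m+[n∸m]≡n a≤b)) b<size)
      a≤b-a (closed-left a≤b C) y y≤b-a (subst (_∣ y) (sym (gcd-∸ a b a≤b)) g∣y)
  recurse (no a≰b-a) = lift-right a≤b C (gcd[m,n]∣m a b) b-a≤a λ y y≤a g∣y →
    closed⇒multiples size (b ∸ a) a (subst (_< size) (sym (trans (+-comm (b ∸ a) a) (m+[n∸m]≡n a≤b))) b<size)
      b-a≤a (closed-right a≤b C) y y≤a (subst (_∣ y) (sym (trans (gcd-comm (b ∸ a) a) (gcd-∸ a b a≤b))) g∣y)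
    where
    b-a≤a : b ∸ a ≤ a
    b-a≤a = <⇒≤ (≰⇒> a≰b-a)

-- A set closed under x ↦ b − x for x ≤ a and under x ↦ x − a (where a > 0) is
-- closed under x ↦ b − x on all of [0, b]: for x > a, reflect x − a instead
-- and translate the result down by a.
reflect-extend : ∀ {P : ℕ → Set} {a b} → 0 < a →
  (∀ x → x ≤ a → P x → P (b ∸ x)) → (∀ x → a ≤ x → P x → P (x ∸ a)) →
  ∀ x → x ≤ b → P x → P (b ∸ x)
reflect-extend {P} {a} {b} 0<a reflect-small shift-down = <-rec Goal reflect
  where
  Goal : ℕ → Set
  Goal x = x ≤ b → P x → P (b ∸ x)

  reflect : ∀ x → (∀ {y} → y < x → Goal y) → Goal x
  reflect x smaller x≤b px with x ≤? a
  ... | yes x≤a = reflect-small x x≤a px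
  ... | no  x≰a = subst P b∸y∸a≡b∸x
          (shift-down (b ∸ y) a≤b∸y (smaller (∸-monoʳ-< 0<a a≤x) (≤-trans (m∸n≤m x a) x≤b) (shift-down x a≤x px)))
    where
    a≤x : a ≤ x
    a≤x = <⇒≤ (≰⇒> x≰a)
    y : ℕ
    y = x ∸ a
    y+a≡x : y + a ≡ x
    y+a≡x = m∸n+n≡m a≤x
    a≤b∸y : a ≤ b ∸ y
    a≤b∸y = m+n≤o⇒m≤o∸n a (subst (_≤ b) (trans (sym y+a≡x) (+-comm y a)) x≤b)
    b∸y∸a≡b∸x : b ∸ y ∸ a ≡ b ∸ x
    b∸y∸a≡b∸x = trans (∸-+-assoc b y a) (cong (b ∸_) y+a≡x)

Aligned : ℕ → ℕ → ℕ → Set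
Aligned d i j = d ∣ i ⊎ d ∣ j ⊎ d ∣ i + j ⊎ (j ≤ i × d ∣ i ∸ j) ⊎ (i ≤ j × d ∣ j ∸ i)

∣-difference : ∀ d r a b → d ∣ (r + a * d) ∸ (r + b * d)
∣-difference d r a b = divides (a ∸ b) (trans ([m+n]∸[m+o]≡n∸o r (a * d) (b * d)) (sym (*-distribʳ-∸ d a b)))

same-residue : ∀ d r a b →
  (r + b * d ≤ r + a * d × d ∣ (r + a * d) ∸ (r + b * d)) ⊎ (r + a * d ≤ r + b * d × d ∣ (r + b * d) ∸ (r + a * d))
same-residue d r a b with ≤-total b a
... | inj₁ b≤a = inj₁ (+-monoʳ-≤ r (*-monoˡ-≤ d b≤a) , ∣-difference d r a b)
... | inj₂ a≤b = inj₂ (+-monoʳ-≤ r (*-monoˡ-≤ d a≤b) , ∣-difference d r b a)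

complementary-sum : ∀ r s a b → (r + a * (r + s)) + (s + b * (r + s)) ≡ suc (a + b) * (r + s)
complementary-sum = solve-∀

complementary-residues : ∀ r s a b → r + s ∣ (r + a * (r + s)) + (s + b * (r + s))
complementary-residues r s a b = divides (suc (a + b)) (complementary-sum r s a b)

4+k≰3 : ∀ {k} → ¬ (4 + k ≤ 3)
4+k≰3 (s≤s (s≤s (s≤s ())))

-- For d ≤ 3 the only nonzero residues mod d are 1 and 2, so two residues
-- are zero, equal, or add up to d (which is then 3).
residue-cases : ∀ {d} r s → r < d → s < d → d ≤ 3 → r ≡ 0 ⊎ s ≡ 0 ⊎ r ≡ s ⊎ r + s ≡ d
residue-cases 0       s       _   _   _   = inj₁ refl
residue-cases (suc r) 0       _   _   _   = inj₂ (inj₁ refl)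
residue-cases 1       1       _   _   _   = inj₂ (inj₂ (inj₁ refl))
residue-cases 2       2       _   _   _   = inj₂ (inj₂ (inj₁ refl))
residue-cases 1       2       _   2<d d≤3 = inj₂ (inj₂ (inj₂ (≤-antisym 2<d d≤3)))
residue-cases 2       1       2<d _   d≤3 = inj₂ (inj₂ (inj₂ (≤-antisym 2<d d≤3)))
residue-cases (suc (suc (suc _))) _ r<d _ d≤3 = ⊥-elim (4+k≰3 (≤-trans r<d d≤3))
residue-cases _ (suc (suc (suc _))) _ s<d d≤3 = ⊥-elim (4+k≰3 (≤-trans s<d d≤3))

aligned-from-residues : ∀ d r s a b → r ≡ 0 ⊎ s ≡ 0 ⊎ r ≡ s ⊎ r + s ≡ d → Aligned d (r + a * d) (s + b * d)
aligned-from-residues d r s a b (inj₁ refl)                = inj₁ (divides a refl)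
aligned-from-residues d r s a b (inj₂ (inj₁ refl))         = inj₂ (inj₁ (divides b refl))
aligned-from-residues d r s a b (inj₂ (inj₂ (inj₁ refl)))  = inj₂ (inj₂ (inj₂ (same-residue d r a b)))
aligned-from-residues d r s a b (inj₂ (inj₂ (inj₂ refl)))  = inj₂ (inj₂ (inj₁ (complementary-residues r s a b)))

aligned-small : ∀ d → 0 < d → d ≤ 3 → ∀ i j → Aligned d i j
aligned-small d@(suc _) _ d≤3 i j = subst₂ (Aligned d) (sym (m≡m%n+[m/n]*n i d)) (sym (m≡m%n+[m/n]*n j d))
  (aligned-from-residues d (i % d) (j % d) (i / d) (j / d) (residue-cases (i % d) (j % d) (m%n<n i d) (m%n<n j d) d≤3))

canInc-< : ∀ {b x} → x < b → canInc b x ≡ true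
canInc-< {suc b} {zero}  _         = refl
canInc-< {suc b} {suc x} (s≤s x<b) = canInc-< x<b

canInc-true : ∀ {b x} → canInc b x ≡ true → x < b
canInc-true {suc b} {zero}  _    = s≤s z≤n
canInc-true {suc b} {suc x} free = s≤s (canInc-true free)

canInc-edge : ∀ b → canInc b b ≡ false
canInc-edge zero    = refl
canInc-edge (suc b) = canInc-edge b

canDec-∸ : ∀ {b i} → i < b → canDec (b ∸ i) ≡ true
canDec-∸ {b} {i} i<b with b ∸ i | m<n⇒0<n∸m i<b
... | suc _ | _ = refl

canInc-+ : ∀ {bound a k i} → k + a ≤ bound → i < k → canInc bound (i + a) ≡ true
canInc-+ {a = a} le i<k = canInc-< (≤-trans (+-monoˡ-≤ a i<k) le)

both : ∀ {x y : Bool} → x ≡ true → y ≡ true → (if x then y else false) ≡ true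
both refl refl = refl

both⁻ : ∀ {x y : Bool} → (if x then y else false) ≡ true → x ≡ true × y ≡ true
both⁻ {true} {true} _ = refl , refl

if-false : ∀ x → (if x then false else false) ≡ false
if-false true  = refl
if-false false = refl

∸-suc : ∀ b i → b ∸ i ∸ 1 ≡ b ∸ suc i
∸-suc b i = trans (∸-+-assoc b i 1) (cong (b ∸_) (+-comm i 1))

≤-+0 : ∀ {k b} → k ≤ b → k + 0 ≤ b
≤-+0 {k} = subst (_≤ _) (sym (+-identityʳ k))

module Grid (n m : ℕ) where

  -- A ray: squares r 0, …, r k, each one in-grid step in direction d from the
  -- previous one.  Rays in the grid have at most n + m steps, the fuel of slide.
  record Ray (d : Dir) (k : ℕ) (r : ℕ → Square) : Set where
    field
      advance : ∀ i → i < k → step d (r i) ≡ r (suc i)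
      inside  : ∀ i → i < k → inGridStep n m d (r i) ≡ true
      short   : k ≤ n + m
  open Ray

  ray-tail : ∀ {d k r} → Ray d (suc k) r → Ray d k (λ i → r (suc i))
  ray-tail R = record
    { advance = λ i i<k → advance R (suc i) (s≤s i<k)
    ; inside  = λ i i<k → inside R (suc i) (s≤s i<k)
    ; short   = ≤-trans (n≤1+n _) (short R)
    }

  slideFuel-go : ∀ f d p → inGridStep n m d p ≡ true →
    slideFuel n m (suc f) d p ≡ (p ∷ proj₁ (slideFuel n m f d (step d p)) , proj₂ (slideFuel n m f d (step d p)))
  slideFuel-go f d p free rewrite free with slideFuel n m f d (step d p)
  ... | (ps , q) = refl

  slideFuel-stop : ∀ f d p → inGridStep n m d p ≡ false → slideFuel n m (suc f) d p ≡ (p ∷ [] , p)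
  slideFuel-stop f d p blocked rewrite blocked = refl

  slideFuel-start : ∀ f d p → p ∈ proj₁ (slideFuel n m f d p)
  slideFuel-start zero    d p = here refl
  slideFuel-start (suc f) d p with inGridStep n m d p
  ... | false = here refl
  ... | true with slideFuel n m f d (step d p)
  ...   | (ps , q) = here refl

  ray-passes-fuel : ∀ f {d k r} → Ray d k r → k < f → ∀ i → i ≤ k → r i ∈ proj₁ (slideFuel n m f d (r 0))
  ray-passes-fuel f R _ zero _ = slideFuel-start f _ _
  ray-passes-fuel (suc f) {d} {suc k} {r} R (s≤s k<f) (suc i) (s≤s i≤k)
    rewrite slideFuel-go f d (r 0) (inside R 0 (s≤s z≤n)) | advance R 0 (s≤s z≤n)
    = there (ray-passes-fuel f (ray-tail R) k<f i i≤k)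

  ray-ends-fuel : ∀ f {d k r} → Ray d k r → k < f → inGridStep n m d (r k) ≡ false →
                  proj₂ (slideFuel n m f d (r 0)) ≡ r k
  ray-ends-fuel (suc f) {d} {zero} {r} R _ blocked rewrite slideFuel-stop f d (r 0) blocked = refl
  ray-ends-fuel (suc f) {d} {suc k} {r} R (s≤s k<f) blocked
    rewrite slideFuel-go f d (r 0) (inside R 0 (s≤s z≤n)) | advance R 0 (s≤s z≤n)
    = ray-ends-fuel f (ray-tail R) k<f blocked

  ray-passes : ∀ {d k r q} → Ray d k r → ∀ i → i ≤ k → r i ≡ q → q ∈ proj₁ (slide n m d (r 0))
  ray-passes R i i≤k refl = ray-passes-fuel _ R (s≤s (short R)) i i≤k

  ray-ends : ∀ {d k r q} → Ray d k r → r k ≡ q → inGridStep n m d q ≡ false → proj₂ (slide n m d (r 0)) ≡ q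
  ray-ends R refl blocked = ray-ends-fuel _ R (s≤s (short R)) blocked

  -- Increasing coordinates are
  -- written i + a, so that r 0 is the start square on the nose.
  short-row : ∀ {k} → k ≤ n → k ≤ n + m
  short-row = m≤n⇒m≤n+o m

  short-col : ∀ {k} → k ≤ m → k ≤ n + m
  short-col = m≤n⇒m≤o+n n

  ray-S : ∀ a b k → k + a ≤ n → Ray S k (λ i → (i + a , b))
  ray-S a b k le = record
    { advance = λ _ _ → refl
    ; inside  = λ _ i<k → canInc-+ le i<k
    ; short   = short-row (m+n≤o⇒m≤o k le) }

  ray-N : ∀ a b → a ≤ n → Ray N a (λ i → (a ∸ i , b))
  ray-N a b a≤n = record
    { advance = λ i _ → cong (_, b) (∸-suc a i)
    ; inside  = λ _ i<a → canDec-∸ i<a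
    ; short   = short-row a≤n }

  ray-E : ∀ a b k → k + b ≤ m → Ray E k (λ i → (a , i + b))
  ray-E a b k le = record
    { advance = λ _ _ → refl
    ; inside  = λ _ i<k → canInc-+ le i<k
    ; short   = short-col (m+n≤o⇒m≤o k le) }

  ray-SE : ∀ a b k → k + a ≤ n → k + b ≤ m → Ray SE k (λ i → (i + a , i + b))
  ray-SE a b k le₁ le₂ = record
    { advance = λ _ _ → refl
    ; inside  = λ _ i<k → both (canInc-+ le₁ i<k) (canInc-+ le₂ i<k)
    ; short   = short-row (m+n≤o⇒m≤o k le₁) }

  ray-SW : ∀ a b k → k + a ≤ n → k ≤ b → Ray SW k (λ i → (i + a , b ∸ i))
  ray-SW a b k le k≤b = record
    { advance = λ i _ → cong (suc (i + a) ,_) (∸-suc b i)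
    ; inside  = λ _ i<k → both (canInc-+ le i<k) (canDec-∸ (<-≤-trans i<k k≤b))
    ; short   = short-row (m+n≤o⇒m≤o k le) }

  ray-NW : ∀ a b k → k ≤ a → a ≤ n → k ≤ b → Ray NW k (λ i → (a ∸ i , b ∸ i))
  ray-NW a b k k≤a a≤n k≤b = record
    { advance = λ i _ → cong₂ _,_ (∸-suc a i) (∸-suc b i)
    ; inside  = λ _ i<k → both (canDec-∸ (<-≤-trans i<k k≤a)) (canDec-∸ (<-≤-trans i<k k≤b))
    ; short   = short-row (≤-trans k≤a a≤n) }

  stop-E : ∀ a → inGridStep n m E (a , m) ≡ false
  stop-E a = canInc-edge m

  stop-SE : ∀ b → inGridStep n m SE (n , b) ≡ false
  stop-SE b rewrite canInc-edge n = refl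

  stop-SW-bottom : ∀ b → inGridStep n m SW (n , b) ≡ false
  stop-SW-bottom b rewrite canInc-edge n = refl

  stop-SW-left : ∀ a → inGridStep n m SW (a , 0) ≡ false
  stop-SW-left a = if-false (canInc n a)

  ray-W : ∀ a b → b ≤ m → Ray W b (λ i → (a , b ∸ i))
  ray-W a b b≤m = record
    { advance = λ i _ → cong (a ,_) (∸-suc b i)
    ; inside  = λ _ i<b → canDec-∸ i<b
    ; short   = short-col b≤m }

  to-top : ∀ a b → a ≤ n → proj₂ (slide n m N (a , b)) ≡ (0 , b)
  to-top a b a≤n = ray-ends (ray-N a b a≤n) (cong (_, b) (n∸n≡0 a)) refl

  to-left : ∀ a b → b ≤ m → proj₂ (slide n m W (a , b)) ≡ (a , 0)
  to-left a b b≤m = ray-ends (ray-W a b b≤m) (cong (a ,_) (n∸n≡0 b)) refl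

  to-right : ∀ a → proj₂ (slide n m E (a , 0)) ≡ (a , m)
  to-right a = ray-ends (ray-E a 0 m (≤-+0 ≤-refl)) (cong (a ,_) (+-identityʳ m)) (stop-E a)

  top-to-left : ∀ x → x ≤ n → proj₂ (slide n m SW (0 , x)) ≡ (x , 0)
  top-to-left x x≤n = ray-ends (ray-SW 0 x x (≤-+0 x≤n) ≤-refl)
    (cong₂ _,_ (+-identityʳ x) (n∸n≡0 x)) (stop-SW-left x)

  endPos : Square → List Dir → Square
  endPos p []       = p
  endPos p (d ∷ ds) = endPos (proj₂ (slide n m d p)) ds

  endPos-++ : ∀ p ds es → endPos p (ds ++ es) ≡ endPos (endPos p ds) es
  endPos-++ p []       es = refl
  endPos-++ p (d ∷ ds) es = endPos-++ _ ds es

  passed-∷ : ∀ p d ds → passed n m p (d ∷ ds) ≡ proj₁ (slide n m d p) ++ passed n m (proj₂ (slide n m d p)) ds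
  passed-∷ p d ds with slide n m d p
  ... | (ps , q) = refl

  passed-start : ∀ p ds → p ∈ passed n m p ds
  passed-start p []       = here refl
  passed-start p (d ∷ ds) = subst (p ∈_) (sym (passed-∷ p d ds)) (∈-++⁺ˡ (slideFuel-start (suc (n + m)) d p))

  passed-++ˡ : ∀ {q} p ds es → q ∈ passed n m p ds → q ∈ passed n m p (ds ++ es)
  passed-++ˡ p []       es (here refl) = passed-start p es
  passed-++ˡ {q} p (d ∷ ds) es h with ∈-++⁻ (proj₁ (slide n m d p)) (subst (q ∈_) (passed-∷ p d ds) h)
  ... | inj₁ h₁ = subst (q ∈_) (sym (passed-∷ p d (ds ++ es))) (∈-++⁺ˡ h₁)
  ... | inj₂ h₂ = subst (q ∈_) (sym (passed-∷ p d (ds ++ es))) (∈-++⁺ʳ _ (passed-++ˡ _ ds es h₂))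

  passed-++ʳ : ∀ {q} p ds es → q ∈ passed n m (endPos p ds) es → q ∈ passed n m p (ds ++ es)
  passed-++ʳ p []       es h = h
  passed-++ʳ {q} p (d ∷ ds) es h = subst (q ∈_) (sym (passed-∷ p d (ds ++ es))) (∈-++⁺ʳ _ (passed-++ʳ _ ds es h))

  origin : Square
  origin = (0 , 0)

  Reach : Square → Set
  Reach p = Σ (List Dir) λ ds → endPos origin ds ≡ p

  Visit : Square → Set
  Visit q = Σ (List Dir) λ ds → q ∈ passed n m origin ds

  go : ∀ {p q} → Reach p → (d : Dir) → proj₂ (slide n m d p) ≡ q → Reach q
  go (ds , reached) d ends = ds ++ d ∷ [] ,
    trans (endPos-++ origin ds (d ∷ [])) (trans (cong (λ r → proj₂ (slide n m d r)) reached) ends)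

  visit : ∀ {p q} → Reach p → (d : Dir) → q ∈ proj₁ (slide n m d p) → Visit q
  visit {p} {q} (ds , refl) d passes = ds ++ d ∷ [] ,
    passed-++ʳ origin ds (d ∷ []) (subst (q ∈_) (sym (passed-∷ p d [])) (∈-++⁺ˡ passes))

  InGrid : Square → Set
  InGrid (i , j) = i ≤ n × j ≤ m

  step-in : ∀ d p → InGrid p → inGridStep n m d p ≡ true → InGrid (step d p)
  step-in N  (i , j) (i≤n , j≤m) free = ≤-trans (m∸n≤m i 1) i≤n , j≤m
  step-in S  (i , j) (i≤n , j≤m) free = canInc-true free , j≤m
  step-in E  (i , j) (i≤n , j≤m) free = i≤n , canInc-true free
  step-in W  (i , j) (i≤n , j≤m) free = i≤n , ≤-trans (m∸n≤m j 1) j≤m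
  step-in NE (i , j) (i≤n , j≤m) free = ≤-trans (m∸n≤m i 1) i≤n , canInc-true (proj₂ (both⁻ free))
  step-in NW (i , j) (i≤n , j≤m) free = ≤-trans (m∸n≤m i 1) i≤n , ≤-trans (m∸n≤m j 1) j≤m
  step-in SE (i , j) (i≤n , j≤m) free = canInc-true (proj₁ (both⁻ free)) , canInc-true (proj₂ (both⁻ free))
  step-in SW (i , j) (i≤n , j≤m) free = canInc-true (proj₁ (both⁻ free)) , ≤-trans (m∸n≤m j 1) j≤m

  slideFuel-in : ∀ f d p → InGrid p → InGrid (proj₂ (slideFuel n m f d p))
  slideFuel-in zero    d p p-in = p-in
  slideFuel-in (suc f) d p p-in with inGridStep n m d p in free
  ... | false = p-in
  ... | true  with slideFuel n m f d (step d p) in rest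
  ...   | (ps , q) = subst (λ r → InGrid (proj₂ r)) rest (slideFuel-in f d (step d p) (step-in d p p-in free))

  endPos-in : ∀ p ds → InGrid p → InGrid (endPos p ds)
  endPos-in p []       p-in = p-in
  endPos-in p (d ∷ ds) p-in = endPos-in _ ds (slideFuel-in (suc (n + m)) d p p-in)

  home : ∀ p → InGrid p → endPos p (N ∷ W ∷ []) ≡ origin
  home (a , b) (a≤n , b≤m) rewrite to-top a b a≤n = to-left 0 b b≤m

  Tour : List Square → Set
  Tour qs = Σ (List Dir) λ ds → endPos origin ds ≡ origin × (∀ q → q ∈ qs → q ∈ passed n m origin ds)

  visit-and-return : ∀ {q} → Visit q → Tour (q ∷ [])
  visit-and-return (ds , passes) = ds ++ N ∷ W ∷ [] ,
    trans (endPos-++ origin ds (N ∷ W ∷ [])) (home _ (endPos-in origin ds (z≤n , z≤n))) ,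
    λ { _ (here refl) → passed-++ˡ origin ds _ passes }

  -- Closed walks can be concatenated, so squares that are visited one at a
  -- time are all visited by a single move sequence.
  tour : ∀ qs → (∀ q → q ∈ qs → Visit q) → Tour qs
  tour []       _      = [] , refl , λ _ ()
  tour (q ∷ qs) visits with visit-and-return (visits q (here refl)) | tour qs (λ q' h → visits q' (there h))
  ... | (ds , back₁ , covers₁) | (es , back₂ , covers₂) =
    ds ++ es , trans (endPos-++ origin ds es) (trans (cong (λ r → endPos r es) back₁) back₂) , covers
    where
    covers : ∀ q' → q' ∈ q ∷ qs → q' ∈ passed n m origin (ds ++ es)
    covers q' (here refl) = passed-++ˡ origin ds es (covers₁ q' (here refl))
    covers q' (there h)   = passed-++ʳ origin ds es (subst (λ r → q' ∈ passed n m r es) (sym back₁) (covers₂ q' h))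

-- The top row: with 0 < n ≤ m, every column x ≤ m divisible by gcd n m can be
-- reached on row 0, because the reachable columns are Closed for (n, m).
module TopRow {n m : ℕ} (0<n : 0 < n) (n≤m : n ≤ m) where
  open Grid n m

  Top : ℕ → Set
  Top x = Reach (0 , x)

  -- x ↦ n − x: SW to (x, 0), SE to the bottom row at (n, n − x), N.
  reflect-n : ∀ x → x ≤ n → Top x → Top (n ∸ x)
  reflect-n x x≤n top = go (go (go top SW (top-to-left x x≤n)) SE diagonal) N (to-top n (n ∸ x) ≤-refl)
    where
    diagonal : proj₂ (slide n m SE (x , 0)) ≡ (n , n ∸ x)
    diagonal = ray-ends
      (ray-SE x 0 (n ∸ x) (≤-reflexive (m∸n+n≡m x≤n)) (≤-+0 (≤-trans (m∸n≤m n x) n≤m)))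
      (cong₂ _,_ (m∸n+n≡m x≤n) (+-identityʳ (n ∸ x))) (stop-SE (n ∸ x))

  -- x ↦ m − x for x ≤ n: SW to (x, 0), E to (x, m), NW back to row 0.
  reflect-m : ∀ x → x ≤ n → Top x → Top (m ∸ x)
  reflect-m x x≤n top = go (go (go top SW (top-to-left x x≤n)) E (to-right x)) NW diagonal
    where
    diagonal : proj₂ (slide n m NW (x , m)) ≡ (0 , m ∸ x)
    diagonal = ray-ends (ray-NW x m x ≤-refl x≤n (≤-trans x≤n n≤m)) (cong (_, m ∸ x) (n∸n≡0 x)) refl

  -- x ↦ x + n: SE to the bottom row at (n, x + n), N.
  shift-n : ∀ x → x + n ≤ m → Top x → Top (x + n)
  shift-n x le top = go (go top SE diagonal) N (to-top n (x + n) ≤-refl)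
    where
    diagonal : proj₂ (slide n m SE (0 , x)) ≡ (n , x + n)
    diagonal = ray-ends (ray-SE 0 x n (≤-+0 ≤-refl) (subst (_≤ m) (+-comm x n) le))
      (cong₂ _,_ (+-identityʳ n) (+-comm n x)) (stop-SE (x + n))

  -- x ↦ x − n: SW to the bottom row at (n, x − n), N.
  shift-down : ∀ x → n ≤ x → Top x → Top (x ∸ n)
  shift-down x n≤x top = go (go top SW diagonal) N (to-top n (x ∸ n) ≤-refl)
    where
    diagonal : proj₂ (slide n m SW (0 , x)) ≡ (n , x ∸ n)
    diagonal = ray-ends (ray-SW 0 x n (≤-+0 ≤-refl) n≤x)
      (cong (_, x ∸ n) (+-identityʳ n)) (stop-SW-bottom (x ∸ n))

  top-closed : Closed Top n m
  top-closed = record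
    { has-zero  = [] , refl
    ; reflect-a = reflect-n
    ; reflect-b = reflect-extend 0<n reflect-m shift-down
    ; shift-a   = shift-n
    }

  top-reach : ∀ x → x ≤ m → gcd n m ∣ x → Top x
  top-reach = closed⇒multiples (suc (n + m)) n m ≤-refl n≤m top-closed

  -- A square aligned with gcd n m is visited: slide from a reachable square
  -- of the top row (or of the left or right edge) along its row, column or
  -- diagonal.
  module _ {i j : ℕ} (i≤n : i ≤ n) (j≤m : j ≤ m) where

    visit-row : gcd n m ∣ i → Visit (i , j)
    visit-row g∣i = visit (go (top-reach i (≤-trans i≤n n≤m) g∣i) SW (top-to-left i i≤n)) E
      (ray-passes (ray-E i 0 m (≤-+0 ≤-refl)) j j≤m (cong (i ,_) (+-identityʳ j)))

    visit-column : gcd n m ∣ j → Visit (i , j)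
    visit-column g∣j = visit (top-reach j j≤m g∣j) S
      (ray-passes (ray-S 0 j n (≤-+0 ≤-refl)) i i≤n (cong (_, j) (+-identityʳ i)))

    -- Anti-diagonal from the top row when i + j ≤ m; otherwise from the right
    -- edge at (i + j − m, m), which is reached through the left edge.
    visit-anti-diagonal : gcd n m ∣ i + j → Visit (i , j)
    visit-anti-diagonal g∣i+j with i + j ≤? m
    ... | yes i+j≤m = visit (top-reach (i + j) i+j≤m g∣i+j) SW
          (ray-passes (ray-SW 0 (i + j) i (≤-+0 i≤n) (m≤m+n i j)) i ≤-refl
            (cong₂ _,_ (+-identityʳ i) (m+n∸m≡n i j)))
    ... | no  i+j≰m = visit right-edge SW
          (ray-passes (ray-SW t m (m ∸ j) (≤-trans (≤-reflexive [m∸j]+t≡i) i≤n) (m∸n≤m m j)) (m ∸ j) ≤-refl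
            (cong₂ _,_ [m∸j]+t≡i (m∸[m∸n]≡n j≤m)))
      where
      m≤i+j : m ≤ i + j
      m≤i+j = <⇒≤ (≰⇒> i+j≰m)
      t : ℕ
      t = i + j ∸ m
      t≤n : t ≤ n
      t≤n = ≤-trans (∸-monoˡ-≤ m (+-monoʳ-≤ i j≤m)) (≤-trans (≤-reflexive (m+n∸n≡m i m)) i≤n)
      right-edge : Reach (t , m)
      right-edge = go (go (top-reach t (≤-trans t≤n n≤m) (∣-∸ g∣i+j (gcd[m,n]∣n n m) m≤i+j)) SW (top-to-left t t≤n))
                      E (to-right t)
      [m∸j]+t≡i : (m ∸ j) + t ≡ i
      [m∸j]+t≡i = +-cancelʳ-≡ j ((m ∸ j) + t) i (begin
        (m ∸ j) + t + j   ≡⟨ +-comm ((m ∸ j) + t) j ⟩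
        j + ((m ∸ j) + t) ≡⟨ sym (+-assoc j (m ∸ j) t) ⟩
        j + (m ∸ j) + t   ≡⟨ cong (_+ t) (m+[n∸m]≡n j≤m) ⟩
        m + t             ≡⟨ m+[n∸m]≡n m≤i+j ⟩
        i + j             ∎)
        where open ≡-Reasoning

    visit-diagonal-below : j ≤ i → gcd n m ∣ i ∸ j → Visit (i , j)
    visit-diagonal-below j≤i g∣i∸j =
      visit (go (top-reach (i ∸ j) (≤-trans i∸j≤n n≤m) g∣i∸j) SW (top-to-left (i ∸ j) i∸j≤n)) SE
        (ray-passes (ray-SE (i ∸ j) 0 j (≤-trans (≤-reflexive (m+[n∸m]≡n j≤i)) i≤n) (≤-+0 j≤m))
          j ≤-refl (cong₂ _,_ (m+[n∸m]≡n j≤i) (+-identityʳ j)))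
      where
      i∸j≤n : i ∸ j ≤ n
      i∸j≤n = ≤-trans (m∸n≤m i j) i≤n

    visit-diagonal-above : i ≤ j → gcd n m ∣ j ∸ i → Visit (i , j)
    visit-diagonal-above i≤j g∣j∸i = visit (top-reach (j ∸ i) (≤-trans (m∸n≤m j i) j≤m) g∣j∸i) SE
      (ray-passes (ray-SE 0 (j ∸ i) i (≤-+0 i≤n) (≤-trans (≤-reflexive (m+[n∸m]≡n i≤j)) j≤m))
        i ≤-refl (cong₂ _,_ (+-identityʳ i) (m+[n∸m]≡n i≤j)))

    visit-aligned : Aligned (gcd n m) i j → Visit (i , j)
    visit-aligned (inj₁ g∣i)                          = visit-row g∣i
    visit-aligned (inj₂ (inj₁ g∣j))                   = visit-column g∣j
    visit-aligned (inj₂ (inj₂ (inj₁ g∣i+j)))          = visit-anti-diagonal g∣i+j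
    visit-aligned (inj₂ (inj₂ (inj₂ (inj₁ (j≤i , g))))) = visit-diagonal-below j≤i g
    visit-aligned (inj₂ (inj₂ (inj₂ (inj₂ (i≤j , g))))) = visit-diagonal-above i≤j g

mainTheorem6 : (n m : ℕ) → 0 < n → n ≤ m → gcd n m ≤ 3 → AllCoveredNoBlocks n m
mainTheorem6 n m 0<n n≤m gcd≤3 = moves , covered
  where
  open Grid n m
  open TopRow 0<n n≤m

  squares : List Square
  squares = cartesianProduct (upTo (suc n)) (upTo (suc m))

  0<gcd : 0 < gcd n m
  0<gcd = n≢0⇒n>0 (gcd[m,n]≢0 n m (inj₁ (λ n≡0 → <-irrefl (sym n≡0) 0<n)))

  visits : ∀ q → q ∈ squares → Visit q
  visits (i , j) q∈squares with ∈-cartesianProduct⁻ (upTo (suc n)) (upTo (suc m)) q∈squares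
  ... | i∈ , j∈ = visit-aligned (≤-pred (∈-upTo⁻ i∈)) (≤-pred (∈-upTo⁻ j∈))
                    (aligned-small (gcd n m) 0<gcd gcd≤3 i j)

  all-squares : Tour squares
  all-squares = tour squares visits

  moves : List Dir
  moves = proj₁ all-squares

  covered : ∀ i j → i ≤ n → j ≤ m → (i , j) ∈ passed n m (0 , 0) moves
  covered i j i≤n j≤m = proj₂ (proj₂ all-squares) (i , j)
    (∈-cartesianProduct⁺ (∈-upTo⁺ (s≤s i≤n)) (∈-upTo⁺ (s≤s j≤m)))
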